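{- Let $X$ be a finite set and $r\in X$. Let CUF be the set of circular split systems over $X$ that are unrooted split families, and PP the set of prepyramids over $X\setminus\{r\}$ that are rooted families. Then $\mathcal{S}\mapsto\gamma_r(\mathcal{S})$ is a bijection from CUF to PP.
   Context: A split of $X$ is a partition $A|B$ into two nonempty sets; it is trivial if a part is a singleton; a split system contains all trivial splits. Splits $A_1|B_1$, $A_2|B_2$ are compatible if one of $A_1\cap A_2,A_1\cap B_2,B_1\cap A_2,B_1\cap B_2$ is empty, incompatible otherwise. For a circular ordering $\mathcal{C}=(x_1,\dots,x_n)$ of $X$, $\mathcal{S}(\mathcal{C})$ is the set of splits $\{x_i,\dots,x_{j-1}\}\,|\,\{x_j,\dots,x_{i-1}\}$ ($i<j$); a split system is circular if it is contained in $\mathcal{S}(\mathcal{C})$ for some circular ordering $\mathcal{C}$. An unrooted split family is a split system $\mathcal{S}$ such that for incompatible $A_1|B_1,A_2|B_2\in\mathcal{S}$ the splits $A_1\cap A_2|B_1\cup B_2$, $A_1\cap B_2|A_2\cup B_1$, $A_2\cap B_1|A_1\cup B_2$, $B_1\cap B_2|A_1\cup A_2$ lie in $\mathcal{S}$. $\gamma_r$ sends a split to its part not containing $r$, elementwise on split systems. A prepyramid over $Y$ is a family $\mathcal{P}$ of subsets of $Y$ containing $Y$ and all singletons, such that for some linear order on $Y$ every member is an interval $\{t\mid a\preceq t\preceq b\}$. Sets $A,B$ are compatible if $A\cap B\in\{\emptyset,A,B\}$; a rooted family is a family $\mathcal{F}$ such that for incompatible $A,B\in\mathcal{F}$, all of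 $A\cap B,A\setminus B,B\setminus A,A\cup B$ lie in $\mathcal{F}$. -}

module Defs where

open import Data.Nat using (ℕ; suc)
open import Data.Bool using (Bool; true; false; if_then_else_)
open import Data.Fin using (Fin; _≤_; _<_; punchIn)
open import Data.Fin.Subset using (Subset; _∈_; ∁; _∩_; _∪_; _─_; ⁅_⁆; ⊤; ⊥; Nonempty; Empty)
open import Data.Fin.Permutation using (Permutation′; _⟨$⟩ˡ_)
open import Data.Vec using (tabulate; lookup)
open import Data.Product using (Σ; ∃; ∃-syntax; _×_)
open import Data.Sum using (_⊎_)
open import Relation.Nullary using (¬_)
open import Relation.Binary.PropositionalEquality using (_≡_)
open import Relation.Binary.Core using (Rel)
open import Relation.Binary.Structures using (IsTotalOrder)
open import Function.Bundles using (_⇔_)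
open import Level using (0ℓ)

Family : ℕ → Set₁
Family n = Subset n → Set

_≐_ : ∀ {n} → Family n → Family n → Set
F ≐ G = ∀ A → F A ⇔ G A

-- The split A | ∁ A is represented by either of its parts; a split
-- system is a family of subsets closed under complement (so that S A
-- holds iff the unordered split {A, ∁ A} belongs to the system).

IsSplit : ∀ {n} → Subset n → Set
IsSplit A = Nonempty A × Nonempty (∁ A)

IsSingleton : ∀ {n} → Subset n → Set
IsSingleton {n} A = ∃[ x ] A ≡ ⁅ x ⁆

TrivialSplit : ∀ {n} → Subset n → Set
TrivialSplit A = IsSingleton A ⊎ IsSingleton (∁ A)

record SplitSystem {n} (S : Family n) : Set where
  field
    onlySplits   : ∀ A → S A → IsSplit A
    complClosed  : ∀ A → S A → S (∁ A)
    hasTrivial   : ∀ A → IsSplit A → TrivialSplit A → S A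

CompatibleSplits : ∀ {n} → Subset n → Subset n → Set
CompatibleSplits A₁ A₂ =
  Empty (A₁ ∩ A₂) ⊎ Empty (A₁ ∩ ∁ A₂) ⊎ Empty (∁ A₁ ∩ A₂) ⊎ Empty (∁ A₁ ∩ ∁ A₂)

-- Circular orderings: σ ⟨$⟩ʳ i is x_i (positions 0..n-1);
-- the split {x_i,…,x_{j-1}} | {x_j,…,x_{i-1}} for positions i < j.
CircInterval : ∀ {n} → Permutation′ n → Fin n → Fin n → Subset n → Set
CircInterval σ i j A = ∀ x → (x ∈ A) ⇔ ((i ≤ σ ⟨$⟩ˡ x) × (σ ⟨$⟩ˡ x < j))

InCircularSplits : ∀ {n} → Permutation′ n → Family n → Set
InCircularSplits σ S =
  ∀ A → S A → ∃[ i ] ∃[ j ] (i < j) × (CircInterval σ i j A ⊎ CircInterval σ i j (∁ A))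

Circular : ∀ {n} → Family n → Set
Circular S = SplitSystem S × ∃[ σ ] InCircularSplits σ S

UnrootedSplitFamily : ∀ {n} → Family n → Set
UnrootedSplitFamily S =
  SplitSystem S ×
  (∀ A₁ A₂ → S A₁ → S A₂ → ¬ CompatibleSplits A₁ A₂ →
     S (A₁ ∩ A₂) × S (A₁ ∩ ∁ A₂) × S (∁ A₁ ∩ A₂) × S (∁ A₁ ∩ ∁ A₂))

CUF : ∀ {n} → Family n → Set
CUF S = Circular S × UnrootedSplitFamily S

-- Families over Y = X ∖ {r}, where X = Fin (suc m), r : Fin (suc m),
-- and Y is identified with Fin m via punchIn r.

IsInterval : ∀ {m} → Rel (Fin m) 0ℓ → Subset m → Set
IsInterval _⪯_ B = ∃[ a ] ∃[ b ] (a ⪯ b) × (∀ t → (t ∈ B) ⇔ ((a ⪯ t) × (t ⪯ b)))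

Prepyramid : ∀ {m} → Family m → Set₁
Prepyramid {m} P =
  P ⊤ × (∀ y → P ⁅ y ⁆) ×
  (Σ (Rel (Fin m) 0ℓ) λ le → IsTotalOrder _≡_ le × (∀ B → P B → IsInterval le B))

CompatibleSets : ∀ {m} → Subset m → Subset m → Set
CompatibleSets A B = (A ∩ B ≡ ⊥) ⊎ (A ∩ B ≡ A) ⊎ (A ∩ B ≡ B)

RootedFamily : ∀ {m} → Family m → Set
RootedFamily F =
  ∀ A B → F A → F B → ¬ CompatibleSets A B →
    F (A ∩ B) × F (A ─ B) × F (B ─ A) × F (A ∪ B)

PP : ∀ {m} → Family m → Set₁
PP P = Prepyramid P × RootedFamily P

partAvoiding : ∀ {m} → Fin (suc m) → Subset (suc m) → Subset (suc m)
partAvoiding r A = if lookup A r then ∁ A else A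

γ : ∀ {m} → Fin (suc m) → Subset (suc m) → Subset m
γ r A = tabulate (λ y → lookup (partAvoiding r A) (punchIn r y))

γFam : ∀ {m} → Fin (suc m) → Family (suc m) → Family m
γFam r S B = ∃[ A ] S A × γ r A ≡ B

module Submission where

-- Everything is transported along the inverse of γ_r: lift r B is B ⊆ Y viewed as a subset
-- of X avoiding r, and lift r (γ r A) is the part of A avoiding r.  So a family of splits S
-- is determined by its rooted view B ↦ S (lift r B), which is exactly γFam r S.  It then relates the orders: a circular ordering cut open at r is a linear
-- order on Y turning circular splits into intervals, and listing Y by rank followed by r
-- turns lifts of intervals into circular splits.

open import Defs
open import Data.Nat using (ℕ; suc; zero; _+_; _≤_; _<_; s≤s; z≤n; _<?_)
open import Data.Nat.Properties
  using (≤-refl; ≤-trans; ≤-antisym; ≤-total; ≤-pred; <-trans; <-irrefl; <-asym; <⇒≤; <⇒≱; ≰⇒>; ≮⇒≥;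
         ≤∧≢⇒<; <-≤-trans; ≤-<-trans; 1+n≰n; n≤1+n; n<1+n; >⇒≢; <⇒≢;
         +-suc; +-cancelʳ-≤; +-cancelʳ-≡; +-monoˡ-≤; m≤n+m)
open import Data.Bool using (true; false; not; _∧_)
open import Data.Bool.Properties using (∧-zeroʳ; ∧-identityʳ)
open import Data.Fin as Fin using (Fin; zero; suc; punchIn; punchOut; toℕ; fromℕ; fromℕ<; _≟_)
open import Data.Fin.Properties
  using (punchInᵢ≢i; punchIn-injective; punchIn-punchOut; punchOut-punchIn; punchOut-injective;
         toℕ<n; toℕ-injective; toℕ-fromℕ; toℕ-fromℕ<; any?; <⇒notInjective)
open import Data.Fin.Subset using (Subset; _∈_; _∉_; ∁; _∩_; _∪_; _─_; ⁅_⁆; ⊤; ⊥; ∣_∣; Nonempty; Empty)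
open import Data.Fin.Subset.Properties
  using (∪-∩-booleanAlgebra; ∩-comm; ∩-assoc; ∩-identityʳ; ∩-zeroʳ; ∩-inverseʳ; ∩-distribˡ-∪;
         ∪-identityʳ; ∪-inverseʳ; Empty-unique; ∉⊥; ∈⊤; ⊆⊤; ∣⊤∣≡n; p⊂q⇒∣p∣<∣q∣; _∈?_;
         x∈⁅x⁆; x≢y⇒x∉⁅y⁆; x∈p⇒x∉∁p; x∈∁p⇒x∉p; x∉p⇒x∈∁p)
open import Data.Fin.Permutation
  using (Permutation; Permutation′; _⟨$⟩ˡ_; _⟨$⟩ʳ_; inverseˡ; inverseʳ; permutation; insert; insert-punchIn)
open import Data.Vec using ([]; _∷_; lookup; tabulate; insertAt; removeAt)
open import Data.Vec.Properties
  using (map-insertAt; map-replicate; []=⇒lookup; lookup⇒[]=; lookup∘tabulate; tabulate-cong; tabulate∘lookup;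
         insertAt-lookup; insertAt-punchIn; removeAt-punchOut; removeAt-insertAt; insertAt-removeAt)
open import Data.Product using (Σ; ∃; ∃-syntax; _×_; _,_; proj₁; proj₂)
open import Data.Product.Function.NonDependent.Propositional using (_×-⇔_)
open import Data.Sum using (_⊎_; inj₁; inj₂; [_,_])
open import Data.Sum.Function.Propositional using (_⊎-⇔_)
open import Data.Empty using (⊥-elim)
open import Function using (_∘_)
open import Function.Bundles using (_⇔_; mk⇔; Equivalence)
open import Function.Properties.Equivalence using () renaming (trans to ⇔-trans; sym to ⇔-sym)
open import Level using (0ℓ)
open import Relation.Binary.Core using (Rel)
open import Relation.Binary.Structures using (IsTotalOrder)
open import Relation.Nullary using (¬_; Dec; yes; no; does; contradiction)
open import Relation.Nullary.Decidable using (dec-true)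
open import Relation.Binary.PropositionalEquality
  using (_≡_; _≢_; refl; sym; trans; cong; cong₂; subst; subst₂; isEquivalence; module ≡-Reasoning)
import Algebra.Lattice.Properties.BooleanAlgebra as BooleanAlgebraProperties

open Equivalence using (to; from)

module SubsetAlgebra {n : ℕ} = BooleanAlgebraProperties (∪-∩-booleanAlgebra n)
open SubsetAlgebra using (deMorgan₂) renaming (¬-involutive to ∁-involutive)

subst-⇔ : ∀ {X : Set} (F : X → Set) {A B : X} → A ≡ B → F A ⇔ F B
subst-⇔ F refl = mk⇔ (λ x → x) (λ x → x)

¬-⇔ : ∀ {A B : Set} → A ⇔ B → (¬ A) ⇔ (¬ B)
¬-⇔ A⇔B = mk⇔ (λ ¬a b → ¬a (from A⇔B b)) (λ ¬b a → ¬b (to A⇔B a))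

─-as-∩∁ : ∀ {n} (A B : Subset n) → A ─ B ≡ A ∩ ∁ B
─-as-∩∁ [] [] = refl
─-as-∩∁ (a ∷ A) (true ∷ B) = cong₂ _∷_ (sym (∧-zeroʳ a)) (─-as-∩∁ A B)
─-as-∩∁ (a ∷ A) (false ∷ B) = cong₂ _∷_ (sym (∧-identityʳ a)) (─-as-∩∁ A B)

─≡⊥⇔∩≡ : ∀ {n} (A B : Subset n) → (A ─ B ≡ ⊥) ⇔ (A ∩ B ≡ A)
─≡⊥⇔∩≡ A B = mk⇔ contained disjoint
  where
  open ≡-Reasoning
  contained : A ─ B ≡ ⊥ → A ∩ B ≡ A
  contained A─B≡⊥ = begin
    A ∩ B                 ≡⟨ sym (∪-identityʳ (A ∩ B)) ⟩
    A ∩ B ∪ ⊥             ≡⟨ cong (A ∩ B ∪_) (trans (sym A─B≡⊥) (─-as-∩∁ A B)) ⟩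
    A ∩ B ∪ A ∩ ∁ B       ≡⟨ sym (∩-distribˡ-∪ A B (∁ B)) ⟩
    A ∩ (B ∪ ∁ B)         ≡⟨ cong (A ∩_) (∪-inverseʳ B) ⟩
    A ∩ ⊤                 ≡⟨ ∩-identityʳ A ⟩
    A                     ∎
  disjoint : A ∩ B ≡ A → A ─ B ≡ ⊥
  disjoint A∩B≡A = begin
    A ─ B                 ≡⟨ ─-as-∩∁ A B ⟩
    A ∩ ∁ B               ≡⟨ cong (_∩ ∁ B) (sym A∩B≡A) ⟩
    (A ∩ B) ∩ ∁ B         ≡⟨ ∩-assoc A B (∁ B) ⟩
    A ∩ (B ∩ ∁ B)         ≡⟨ cong (A ∩_) (∩-inverseʳ B) ⟩
    A ∩ ⊥                 ≡⟨ ∩-zeroʳ A ⟩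
    ⊥                     ∎

∉⇒lookup≡false : ∀ {n} {x : Fin n} {A : Subset n} → x ∉ A → lookup A x ≡ false
∉⇒lookup≡false {x = x} {A} x∉A with lookup A x in eq
... | false = refl
... | true = contradiction (lookup⇒[]= x A eq) x∉A

lookup≡false⇒∉ : ∀ {n} {x : Fin n} {A : Subset n} → lookup A x ≡ false → x ∉ A
lookup≡false⇒∉ eq x∈A = contradiction (trans (sym ([]=⇒lookup x∈A)) eq) λ ()

root-or-punchIn : ∀ {m} (r x : Fin (suc m)) → x ≡ r ⊎ ∃[ y ] x ≡ punchIn r y
root-or-punchIn r x with x ≟ r
... | yes x≡r = inj₁ x≡r
... | no x≢r = inj₂ (_ , sym (punchIn-punchOut (x≢r ∘ sym)))

lift : ∀ {m} → Fin (suc m) → Subset m → Subset (suc m)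
lift r B = insertAt B r false

root-∉-lift : ∀ {m} (r : Fin (suc m)) (B : Subset m) → r ∉ lift r B
root-∉-lift r B = lookup≡false⇒∉ (insertAt-lookup B r false)

∈-lift : ∀ {m} (r : Fin (suc m)) (B : Subset m) (y : Fin m) → punchIn r y ∈ lift r B ⇔ y ∈ B
∈-lift r B y = mk⇔
  (λ y∈ → lookup⇒[]= y B (trans (sym (insertAt-punchIn B r false y)) ([]=⇒lookup y∈)))
  (λ y∈ → lookup⇒[]= (punchIn r y) (lift r B) (trans (insertAt-punchIn B r false y) ([]=⇒lookup y∈)))

insertAt-∩ : ∀ {n} (A B : Subset n) i a b → insertAt A i a ∩ insertAt B i b ≡ insertAt (A ∩ B) i (a ∧ b)
insertAt-∩ A B zero a b = refl
insertAt-∩ (x ∷ A) (y ∷ B) (suc i) a b = cong (x ∧ y ∷_) (insertAt-∩ A B i a b)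

∁-lift : ∀ {m} (r : Fin (suc m)) (B : Subset m) → ∁ (lift r B) ≡ insertAt (∁ B) r true
∁-lift r B = map-insertAt not false B r

module _ {m} (r : Fin (suc m)) (B₁ B₂ : Subset m) where
  open ≡-Reasoning

  lift-∩ : lift r B₁ ∩ lift r B₂ ≡ lift r (B₁ ∩ B₂)
  lift-∩ = insertAt-∩ B₁ B₂ r false false

  lift-∩∁ : lift r B₁ ∩ ∁ (lift r B₂) ≡ lift r (B₁ ─ B₂)
  lift-∩∁ = begin
    lift r B₁ ∩ ∁ (lift r B₂)            ≡⟨ cong (lift r B₁ ∩_) (∁-lift r B₂) ⟩
    lift r B₁ ∩ insertAt (∁ B₂) r true    ≡⟨ insertAt-∩ B₁ (∁ B₂) r false true ⟩
    lift r (B₁ ∩ ∁ B₂)                   ≡⟨ cong (lift r) (sym (─-as-∩∁ B₁ B₂)) ⟩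
    lift r (B₁ ─ B₂)                     ∎

  lift-∁∩ : ∁ (lift r B₁) ∩ lift r B₂ ≡ lift r (B₂ ─ B₁)
  lift-∁∩ = begin
    ∁ (lift r B₁) ∩ lift r B₂            ≡⟨ cong (_∩ lift r B₂) (∁-lift r B₁) ⟩
    insertAt (∁ B₁) r true ∩ lift r B₂    ≡⟨ insertAt-∩ (∁ B₁) B₂ r true false ⟩
    lift r (∁ B₁ ∩ B₂)                   ≡⟨ cong (lift r) (∩-comm (∁ B₁) B₂) ⟩
    lift r (B₂ ∩ ∁ B₁)                   ≡⟨ cong (lift r) (sym (─-as-∩∁ B₂ B₁)) ⟩
    lift r (B₂ ─ B₁)                     ∎

  lift-∁∩∁ : ∁ (lift r B₁) ∩ ∁ (lift r B₂) ≡ ∁ (lift r (B₁ ∪ B₂))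
  lift-∁∩∁ = begin
    ∁ (lift r B₁) ∩ ∁ (lift r B₂)                    ≡⟨ cong₂ _∩_ (∁-lift r B₁) (∁-lift r B₂) ⟩
    insertAt (∁ B₁) r true ∩ insertAt (∁ B₂) r true   ≡⟨ insertAt-∩ (∁ B₁) (∁ B₂) r true true ⟩
    insertAt (∁ B₁ ∩ ∁ B₂) r true                    ≡⟨ cong (λ C → insertAt C r true) (deMorgan₂ B₁ B₂) ⟨
    insertAt (∁ (B₁ ∪ B₂)) r true                    ≡⟨ sym (∁-lift r (B₁ ∪ B₂)) ⟩
    ∁ (lift r (B₁ ∪ B₂))                             ∎

lift-⊥ : ∀ {m} (r : Fin (suc m)) → lift r ⊥ ≡ ⊥
lift-⊥ zero = refl
lift-⊥ {suc m} (suc r) = cong (false ∷_) (lift-⊥ r)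

lift-⊤ : ∀ {m} (r : Fin (suc m)) → lift r ⊤ ≡ ∁ ⁅ r ⁆
lift-⊤ {m} zero = cong (false ∷_) (sym (map-replicate not false m))
lift-⊤ {suc m} (suc r) = cong (true ∷_) (lift-⊤ r)

lift-⁅⁆ : ∀ {m} (r : Fin (suc m)) (y : Fin m) → lift r ⁅ y ⁆ ≡ ⁅ punchIn r y ⁆
lift-⁅⁆ zero y = refl
lift-⁅⁆ (suc r) zero = cong (true ∷_) (lift-⊥ r)
lift-⁅⁆ (suc r) (suc y) = cong (false ∷_) (lift-⁅⁆ r y)

Empty-lift : ∀ {m} (r : Fin (suc m)) (B : Subset m) → Empty (lift r B) ⇔ (B ≡ ⊥)
Empty-lift r B = mk⇔
  (λ empty → Empty-unique (λ { (y , y∈B) → empty (punchIn r y , from (∈-lift r B y) y∈B) }))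
  (λ { refl (x , x∈) → ∉⊥ (subst (x ∈_) (lift-⊥ r) x∈) })

partAvoiding-∉ : ∀ {m} {r : Fin (suc m)} {A : Subset (suc m)} → r ∉ A → partAvoiding r A ≡ A
partAvoiding-∉ r∉A rewrite ∉⇒lookup≡false r∉A = refl

partAvoiding-∈ : ∀ {m} {r : Fin (suc m)} {A : Subset (suc m)} → r ∈ A → partAvoiding r A ≡ ∁ A
partAvoiding-∈ r∈A rewrite []=⇒lookup r∈A = refl

partAvoiding-either : ∀ {m} (r : Fin (suc m)) (A : Subset (suc m)) →
  partAvoiding r A ≡ A ⊎ partAvoiding r A ≡ ∁ A
partAvoiding-either r A with r ∈? A
... | yes r∈A = inj₂ (partAvoiding-∈ r∈A)
... | no r∉A = inj₁ (partAvoiding-∉ r∉A)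

root-∉-partAvoiding : ∀ {m} (r : Fin (suc m)) (A : Subset (suc m)) → r ∉ partAvoiding r A
root-∉-partAvoiding r A with r ∈? A
... | yes r∈A = subst (r ∉_) (sym (partAvoiding-∈ r∈A)) (x∈p⇒x∉∁p r∈A)
... | no r∉A = subst (r ∉_) (sym (partAvoiding-∉ r∉A)) r∉A

partAvoiding-∁ : ∀ {m} (r : Fin (suc m)) (A : Subset (suc m)) → partAvoiding r (∁ A) ≡ partAvoiding r A
partAvoiding-∁ r A with r ∈? A
... | yes r∈A = trans (partAvoiding-∉ (x∈p⇒x∉∁p r∈A)) (sym (partAvoiding-∈ r∈A))
... | no r∉A = trans (partAvoiding-∈ (x∉p⇒x∈∁p r∉A)) (trans (∁-involutive A) (sym (partAvoiding-∉ r∉A)))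

γ-as-removeAt : ∀ {m} (r : Fin (suc m)) (A : Subset (suc m)) → γ r A ≡ removeAt (partAvoiding r A) r
γ-as-removeAt r A = trans (tabulate-cong lookup-removeAt) (tabulate∘lookup (removeAt (partAvoiding r A) r))
  where
  lookup-removeAt : ∀ y → lookup (partAvoiding r A) (punchIn r y) ≡ lookup (removeAt (partAvoiding r A) r) y
  lookup-removeAt y = trans (sym (removeAt-punchOut (partAvoiding r A) (punchInᵢ≢i r y ∘ sym)))
                            (cong (lookup (removeAt (partAvoiding r A) r)) (punchOut-punchIn r))

γ-∁ : ∀ {m} (r : Fin (suc m)) (A : Subset (suc m)) → γ r (∁ A) ≡ γ r A
γ-∁ r A = cong (λ C → tabulate (λ y → lookup C (punchIn r y))) (partAvoiding-∁ r A)

γ-lift : ∀ {m} (r : Fin (suc m)) (B : Subset m) → γ r (lift r B) ≡ B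
γ-lift r B = begin
  γ r (lift r B)                          ≡⟨ γ-as-removeAt r (lift r B) ⟩
  removeAt (partAvoiding r (lift r B)) r  ≡⟨ cong (λ C → removeAt C r) (partAvoiding-∉ (root-∉-lift r B)) ⟩
  removeAt (insertAt B r false) r         ≡⟨ removeAt-insertAt B r false ⟩
  B                                       ∎
  where open ≡-Reasoning

lift-γ : ∀ {m} (r : Fin (suc m)) (A : Subset (suc m)) → lift r (γ r A) ≡ partAvoiding r A
lift-γ r A = begin
  lift r (γ r A)                          ≡⟨ cong (lift r) (γ-as-removeAt r A) ⟩
  insertAt (removeAt C r) r false         ≡⟨ cong (insertAt (removeAt C r) r) C-avoids-r ⟩
  insertAt (removeAt C r) r (lookup C r)  ≡⟨ insertAt-removeAt C r ⟩
  C                                       ∎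
  where
  open ≡-Reasoning
  C = partAvoiding r A
  C-avoids-r : false ≡ lookup C r
  C-avoids-r = sym (∉⇒lookup≡false (root-∉-partAvoiding r A))

∈γ-avoiding : ∀ {m} {r : Fin (suc m)} {A : Subset (suc m)} → r ∉ A → ∀ y → y ∈ γ r A ⇔ punchIn r y ∈ A
∈γ-avoiding {r = r} {A} r∉A y =
  ⇔-trans (⇔-sym (∈-lift r (γ r A) y)) (subst-⇔ (punchIn r y ∈_) (trans (lift-γ r A) (partAvoiding-∉ r∉A)))

∈γ-containing : ∀ {m} {r : Fin (suc m)} {A : Subset (suc m)} → r ∈ A → ∀ y → y ∈ γ r A ⇔ punchIn r y ∉ A
∈γ-containing {r = r} {A} r∈A y = ⇔-trans (subst-⇔ (y ∈_) (sym (γ-∁ r A)))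
  (⇔-trans (∈γ-avoiding (x∈p⇒x∉∁p r∈A) y) (mk⇔ x∈∁p⇒x∉p x∉p⇒x∈∁p))

IsSplit-∁ : ∀ {n} {D : Subset n} → IsSplit D → IsSplit (∁ D)
IsSplit-∁ {D = D} (inD , in∁D) = in∁D , subst Nonempty (sym (∁-involutive D)) inD

fromPartAvoiding : ∀ {m} (r : Fin (suc m)) (Q : Subset (suc m) → Set) → (∀ {D} → Q D → Q (∁ D)) →
  ∀ A → Q (partAvoiding r A) → Q A
fromPartAvoiding r Q Q-∁ A q with partAvoiding-either r A
... | inj₁ C≡A = subst Q C≡A q
... | inj₂ C≡∁A = subst Q (∁-involutive A) (Q-∁ (subst Q C≡∁A q))

-- A is a split as soon as its image under γ r is nonempty: the part of A avoiding r
-- then has a point, and r lies in its complement.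
γ-nonempty⇒split : ∀ {m} (r : Fin (suc m)) (A : Subset (suc m)) → Nonempty (γ r A) → IsSplit A
γ-nonempty⇒split r A (y , y∈γA) = fromPartAvoiding r IsSplit IsSplit-∁ A
  ( (punchIn r y , subst (punchIn r y ∈_) (lift-γ r A) (from (∈-lift r (γ r A) y) y∈γA))
  , (r , x∉p⇒x∈∁p (root-∉-partAvoiding r A)) )

compatible-lift : ∀ {m} (r : Fin (suc m)) (B₁ B₂ : Subset m) →
  CompatibleSplits (lift r B₁) (lift r B₂) ⇔ CompatibleSets B₁ B₂
compatible-lift r B₁ B₂ = disjoint ⊎-⇔ (included ⊎-⇔ ⇔-trans no-fourth-quadrant including)
  where
  emptyQuadrant : ∀ {Q B} → Q ≡ lift r B → Empty Q ⇔ (B ≡ ⊥)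
  emptyQuadrant {B = B} Q≡ = ⇔-trans (subst-⇔ Empty Q≡) (Empty-lift r B)
  disjoint : Empty (lift r B₁ ∩ lift r B₂) ⇔ (B₁ ∩ B₂ ≡ ⊥)
  disjoint = emptyQuadrant (lift-∩ r B₁ B₂)
  included : Empty (lift r B₁ ∩ ∁ (lift r B₂)) ⇔ (B₁ ∩ B₂ ≡ B₁)
  included = ⇔-trans (emptyQuadrant (lift-∩∁ r B₁ B₂)) (─≡⊥⇔∩≡ B₁ B₂)
  including : Empty (∁ (lift r B₁) ∩ lift r B₂) ⇔ (B₁ ∩ B₂ ≡ B₂)
  including = ⇔-trans (emptyQuadrant (lift-∁∩ r B₁ B₂))
              (⇔-trans (─≡⊥⇔∩≡ B₂ B₁) (subst-⇔ (_≡ B₂) (∩-comm B₂ B₁)))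
  -- the quadrant of two lifts on the side of r always contains r
  no-fourth-quadrant : (Empty (∁ (lift r B₁) ∩ lift r B₂) ⊎ Empty (∁ (lift r B₁) ∩ ∁ (lift r B₂)))
                     ⇔ Empty (∁ (lift r B₁) ∩ lift r B₂)
  no-fourth-quadrant = mk⇔ [ (λ e → e) , (λ e → ⊥-elim (e (r , r∈))) ] inj₁
    where
    r∈ : r ∈ ∁ (lift r B₁) ∩ ∁ (lift r B₂)
    r∈ = subst (r ∈_) (sym (lift-∁∩∁ r B₁ B₂)) (x∉p⇒x∈∁p (root-∉-lift r (B₁ ∪ B₂)))

ComplementClosed : ∀ {n} → Family n → Set
ComplementClosed S = ∀ A → S A → S (∁ A)

toPartAvoiding : ∀ {m} (r : Fin (suc m)) {S : Family (suc m)} → ComplementClosed S →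
  ∀ {A} → S A → S (partAvoiding r A)
toPartAvoiding r {S} closed {A} s with partAvoiding-either r A
... | inj₁ C≡A = subst S (sym C≡A) s
... | inj₂ C≡∁A = subst S (sym C≡∁A) (closed A s)

rootedView : ∀ {m} → Fin (suc m) → Family (suc m) → Family m
rootedView r S B = S (lift r B)

member⇔rootedView : ∀ {m} (r : Fin (suc m)) {S : Family (suc m)} → ComplementClosed S →
  ∀ {A} → S A ⇔ rootedView r S (γ r A)
member⇔rootedView r {S} closed {A} =
  ⇔-trans (mk⇔ (toPartAvoiding r closed) (fromPartAvoiding r S (closed _) A)) (subst-⇔ S (sym (lift-γ r A)))

γFam≐rootedView : ∀ {m} (r : Fin (suc m)) {S : Family (suc m)} → ComplementClosed S → γFam r S ≐ rootedView r S
γFam≐rootedView r closed B = mk⇔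
  (λ { (A , s , refl) → to (member⇔rootedView r closed) s })
  (λ s → lift r B , s , γ-lift r B)

rootedView-determines : ∀ {m} (r : Fin (suc m)) {S₁ S₂ : Family (suc m)} →
  ComplementClosed S₁ → ComplementClosed S₂ → rootedView r S₁ ≐ rootedView r S₂ → S₁ ≐ S₂
rootedView-determines r closed₁ closed₂ same A =
  ⇔-trans (member⇔rootedView r closed₁) (⇔-trans (same (γ r A)) (⇔-sym (member⇔rootedView r closed₂)))

≐-sym : ∀ {n} {F G : Family n} → F ≐ G → G ≐ F
≐-sym F≐G A = ⇔-sym (F≐G A)

≐-trans : ∀ {n} {F G H : Family n} → F ≐ G → G ≐ H → F ≐ H
≐-trans F≐G G≐H A = ⇔-trans (F≐G A) (G≐H A)

Prepyramid-resp : ∀ {m} {F G : Family m} → F ≐ G → Prepyramid F → Prepyramid G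
Prepyramid-resp F≐G (top , singles , le , tot , intervals) =
  to (F≐G _) top , (λ y → to (F≐G _) (singles y)) , le , tot , λ B g → intervals B (from (F≐G B) g)

RootedFamily-resp : ∀ {m} {F G : Family m} → F ≐ G → RootedFamily F → RootedFamily G
RootedFamily-resp F≐G rooted B₁ B₂ g₁ g₂ incompatible =
  let (q₁ , q₂ , q₃ , q₄) = rooted B₁ B₂ (from (F≐G B₁) g₁) (from (F≐G B₂) g₂) incompatible
  in to (F≐G _) q₁ , to (F≐G _) q₂ , to (F≐G _) q₃ , to (F≐G _) q₄

member-∁ : ∀ {n} {S : Family n} → ComplementClosed S → ∀ {A} → S (∁ A) ⇔ S A
member-∁ {S = S} closed {A} = mk⇔ (λ s → subst S (∁-involutive A) (closed (∁ A) s)) (closed A)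

Quadrants : ∀ {n} → Family n → Subset n → Subset n → Set
Quadrants S A₁ A₂ = S (A₁ ∩ A₂) × S (A₁ ∩ ∁ A₂) × S (∁ A₁ ∩ A₂) × S (∁ A₁ ∩ ∁ A₂)

UnrootedClosed : ∀ {n} → Family n → Set
UnrootedClosed S = ∀ A₁ A₂ → S A₁ → S A₂ → ¬ CompatibleSplits A₁ A₂ → Quadrants S A₁ A₂

∁∁-∩ˡ : ∀ {n} (P : Subset n → Set) {A C : Subset n} → P (A ∩ C) → P (∁ (∁ A) ∩ C)
∁∁-∩ˡ P {A} {C} = subst (λ D → P (D ∩ C)) (sym (∁-involutive A))

∁∁-∩ʳ : ∀ {n} (P : Subset n → Set) {A C : Subset n} → P (C ∩ A) → P (C ∩ ∁ (∁ A))
∁∁-∩ʳ P {A} {C} = subst (λ D → P (C ∩ D)) (sym (∁-involutive A))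

Quadrants-∁ˡ : ∀ {n} {S : Family n} {A₁ A₂} → Quadrants S A₁ A₂ → Quadrants S (∁ A₁) A₂
Quadrants-∁ˡ {S = S} (q₁ , q₂ , q₃ , q₄) = q₃ , q₄ , ∁∁-∩ˡ S q₁ , ∁∁-∩ˡ S q₂

Quadrants-∁ʳ : ∀ {n} {S : Family n} {A₁ A₂} → Quadrants S A₁ A₂ → Quadrants S A₁ (∁ A₂)
Quadrants-∁ʳ {S = S} (q₁ , q₂ , q₃ , q₄) = q₂ , ∁∁-∩ʳ S q₁ , q₄ , ∁∁-∩ʳ S q₃

CompatibleSplits-∁ˡ : ∀ {n} {A₁ A₂ : Subset n} → CompatibleSplits A₁ A₂ → CompatibleSplits (∁ A₁) A₂
CompatibleSplits-∁ˡ (inj₁ e) = inj₂ (inj₂ (inj₁ (∁∁-∩ˡ Empty e)))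
CompatibleSplits-∁ˡ (inj₂ (inj₁ e)) = inj₂ (inj₂ (inj₂ (∁∁-∩ˡ Empty e)))
CompatibleSplits-∁ˡ (inj₂ (inj₂ (inj₁ e))) = inj₁ e
CompatibleSplits-∁ˡ (inj₂ (inj₂ (inj₂ e))) = inj₂ (inj₁ e)

CompatibleSplits-∁ʳ : ∀ {n} {A₁ A₂ : Subset n} → CompatibleSplits A₁ A₂ → CompatibleSplits A₁ (∁ A₂)
CompatibleSplits-∁ʳ (inj₁ e) = inj₂ (inj₁ (∁∁-∩ʳ Empty e))
CompatibleSplits-∁ʳ (inj₂ (inj₁ e)) = inj₁ e
CompatibleSplits-∁ʳ (inj₂ (inj₂ (inj₁ e))) = inj₂ (inj₂ (inj₂ (∁∁-∩ʳ Empty e)))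
CompatibleSplits-∁ʳ (inj₂ (inj₂ (inj₂ e))) = inj₂ (inj₂ (inj₁ e))

fromPartsAvoiding : ∀ {m} (r : Fin (suc m)) (Q : Subset (suc m) → Subset (suc m) → Set) →
  (∀ {D₁ D₂} → Q D₁ D₂ → Q (∁ D₁) D₂) → (∀ {D₁ D₂} → Q D₁ D₂ → Q D₁ (∁ D₂)) →
  ∀ A₁ A₂ → Q (partAvoiding r A₁) (partAvoiding r A₂) → Q A₁ A₂
fromPartsAvoiding r Q Q-∁ˡ Q-∁ʳ A₁ A₂ q =
  fromPartAvoiding r (λ D → Q D A₂) Q-∁ˡ A₁ (fromPartAvoiding r (Q (partAvoiding r A₁)) Q-∁ʳ A₂ q)

quadrants-lift : ∀ {m} (r : Fin (suc m)) {S : Family (suc m)} → ComplementClosed S → ∀ B₁ B₂ →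
  Quadrants S (lift r B₁) (lift r B₂) ⇔
  (rootedView r S (B₁ ∩ B₂) × rootedView r S (B₁ ─ B₂) ×
   rootedView r S (B₂ ─ B₁) × rootedView r S (B₁ ∪ B₂))
quadrants-lift r {S} closed B₁ B₂ =
  subst-⇔ S (lift-∩ r B₁ B₂) ×-⇔ subst-⇔ S (lift-∩∁ r B₁ B₂) ×-⇔
  subst-⇔ S (lift-∁∩ r B₁ B₂) ×-⇔ ⇔-trans (subst-⇔ S (lift-∁∩∁ r B₁ B₂)) (member-∁ closed)

unrooted⇒rooted : ∀ {m} (r : Fin (suc m)) {S : Family (suc m)} → ComplementClosed S →
  UnrootedClosed S → RootedFamily (rootedView r S)
unrooted⇒rooted r closed unrooted B₁ B₂ s₁ s₂ incompatible =
  to (quadrants-lift r closed B₁ B₂)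
     (unrooted (lift r B₁) (lift r B₂) s₁ s₂ (incompatible ∘ to (compatible-lift r B₁ B₂)))

rooted⇒unrooted : ∀ {m} (r : Fin (suc m)) {S : Family (suc m)} → ComplementClosed S →
  RootedFamily (rootedView r S) → UnrootedClosed S
rooted⇒unrooted r {S} closed rooted A₁ A₂ =
  fromPartsAvoiding r Q Q-∁ˡ Q-∁ʳ A₁ A₂
    (subst₂ Q (lift-γ r A₁) (lift-γ r A₂) (on-lifts (γ r A₁) (γ r A₂)))
  where
  Q : Subset _ → Subset _ → Set
  Q D₁ D₂ = S D₁ → S D₂ → ¬ CompatibleSplits D₁ D₂ → Quadrants S D₁ D₂
  Q-∁ˡ : ∀ {D₁ D₂} → Q D₁ D₂ → Q (∁ D₁) D₂
  Q-∁ˡ q s₁ s₂ incompatible =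
    Quadrants-∁ˡ {S = S} (q (to (member-∁ closed) s₁) s₂ (incompatible ∘ CompatibleSplits-∁ˡ))
  Q-∁ʳ : ∀ {D₁ D₂} → Q D₁ D₂ → Q D₁ (∁ D₂)
  Q-∁ʳ q s₁ s₂ incompatible =
    Quadrants-∁ʳ {S = S} (q s₁ (to (member-∁ closed) s₂) (incompatible ∘ CompatibleSplits-∁ʳ))
  on-lifts : ∀ B₁ B₂ → Q (lift r B₁) (lift r B₂)
  on-lifts B₁ B₂ s₁ s₂ incompatible =
    from (quadrants-lift r closed B₁ B₂) (rooted B₁ B₂ s₁ s₂ (incompatible ∘ from (compatible-lift r B₁ B₂)))

interval-nonempty : ∀ {m} {_⪯_ : Rel (Fin m) 0ℓ} → IsTotalOrder _≡_ _⪯_ →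
  ∀ {B} → IsInterval _⪯_ B → Nonempty B
interval-nonempty tot (a , b , a⪯b , mem) = a , from (mem a) (IsTotalOrder.reflexive tot refl , a⪯b)

singleton-member : ∀ {n} {S : Family n} → SplitSystem S → ∀ {x x'} → x' ≢ x → S ⁅ x ⁆
singleton-member ss {x} {x'} x'≢x =
  SplitSystem.hasTrivial ss ⁅ x ⁆
    ((x , x∈⁅x⁆ x) , (x' , x∉p⇒x∈∁p (x≢y⇒x∉⁅y⁆ x'≢x)))
    (inj₁ (x , refl))

γ-⁅root⁆ : ∀ {m} (r : Fin (suc m)) → γ r ⁅ r ⁆ ≡ ⊤
γ-⁅root⁆ r = trans (sym (γ-∁ r ⁅ r ⁆)) (trans (cong (γ r) (sym (lift-⊤ r))) (γ-lift r ⊤))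

γ-⁅punchIn⁆ : ∀ {m} (r : Fin (suc m)) (y : Fin m) → γ r ⁅ punchIn r y ⁆ ≡ ⁅ y ⁆
γ-⁅punchIn⁆ r y = trans (cong (γ r) (sym (lift-⁅⁆ r y))) (γ-lift r ⁅ y ⁆)

position : ∀ {n} → Permutation′ n → Fin n → ℕ
position σ x = toℕ (σ ⟨$⟩ˡ x)

-- Reading the positions 0, …, N-1 of a circle starting just after position p:
-- positions after p keep their value, positions before p are moved past N.
unroll : (N p k : ℕ) → ℕ
unroll N p k with p <? k
... | yes _ = k
... | no _ = k + N

data UnrollCase (N p k : ℕ) : ℕ → Set where
  after  : p < k → UnrollCase N p k k
  before : k < p → UnrollCase N p k (k + N)

unroll-case : ∀ {N p k} → k ≢ p → UnrollCase N p k (unroll N p k)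
unroll-case {p = p} {k} k≢p with p <? k
... | yes p<k = after p<k
... | no p≮k = before (≤∧≢⇒< (≮⇒≥ p≮k) k≢p)

unroll-injective : ∀ {N p k k' u u'} → k < N → k' < N →
  UnrollCase N p k u → UnrollCase N p k' u' → u ≡ u' → k ≡ k'
unroll-injective _ _ (after _) (after _) k≡k' = k≡k'
unroll-injective {N} {k = k} {k'} _ _ (before _) (before _) k+N≡k'+N = +-cancelʳ-≡ N k k' k+N≡k'+N
unroll-injective {N} {k' = k'} k<N _ (after _) (before _) k≡k'+N =
  ⊥-elim (<⇒≱ k<N (subst (N ≤_) (sym k≡k'+N) (m≤n+m N k')))
unroll-injective {N} {k = k} _ k'<N (before _) (after _) k+N≡k' =
  ⊥-elim (<⇒≱ k'<N (subst (N ≤_) k+N≡k' (m≤n+m N k)))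

unroll-after : ∀ {N p k u} → UnrollCase N p k u → p < k → u ≡ k
unroll-after (after _) _ = refl
unroll-after (before k<p) p<k = ⊥-elim (<-asym k<p p<k)

unroll-before : ∀ {N p k u} → UnrollCase N p k u → k < p → u ≡ k + N
unroll-before (after p<k) k<p = ⊥-elim (<-asym k<p p<k)
unroll-before (before _) _ = refl

module _ {m p k : ℕ} (k<N : k < suc m) where

  window-after : ∀ {u I J} → UnrollCase (suc m) p k u → p < I → J ≤ m →
    (I ≤ k × k < suc J) ⇔ (I ≤ u × u ≤ J)
  window-after (after _) _ _ =
    mk⇔ (λ { (I≤k , s≤s k≤J) → I≤k , k≤J }) (λ { (I≤k , k≤J) → I≤k , s≤s k≤J })
  window-after (before k<p) p<I J≤m = mk⇔
    (λ { (I≤k , _) → ⊥-elim (<-asym k<p (<-≤-trans p<I I≤k)) })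
    (λ { (_ , u≤J) → ⊥-elim (1+n≰n (≤-trans (m≤n+m (suc m) k) (≤-trans u≤J J≤m))) })

  window-before : ∀ {u I J} → UnrollCase (suc m) p k u → suc J ≤ p →
    (I ≤ k × k < suc J) ⇔ (I + suc m ≤ u × u ≤ J + suc m)
  window-before {I = I} (after p<k) J<p = mk⇔
    (λ { (_ , k<J) → ⊥-elim (<-asym p<k (<-≤-trans k<J J<p)) })
    (λ { (I+N≤k , _) → ⊥-elim (<⇒≱ k<N (≤-trans (m≤n+m (suc m) I) I+N≤k)) })
  window-before {I = I} {J} (before _) _ = mk⇔
    (λ { (I≤k , s≤s k≤J) → +-monoˡ-≤ (suc m) I≤k , +-monoˡ-≤ (suc m) k≤J })
    (λ { (I+N≤u , u≤J+N) → +-cancelʳ-≤ (suc m) I k I+N≤u , s≤s (+-cancelʳ-≤ (suc m) k J u≤J+N) })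

  window-around : ∀ {u I J} → UnrollCase (suc m) p k u → I ≤ p → p < J → J ≤ m →
    (¬ (I ≤ k × k < J)) ⇔ (J ≤ u × u ≤ I + m)
  window-around {I = I} (after p<k) I≤p _ _ = mk⇔
    (λ outside → ≮⇒≥ (λ k<J → outside (≤-trans I≤p (<⇒≤ p<k) , k<J)) , ≤-trans (≤-pred k<N) (m≤n+m m I))
    (λ { (J≤k , _) (_ , k<J) → <⇒≱ k<J J≤k })
  window-around {I = I} (before k<p) _ p<J J≤m = mk⇔
    (λ outside → ≤-trans J≤m (≤-trans (n≤1+n m) (m≤n+m (suc m) k)) ,
                 subst (_≤ I + m) (sym (+-suc k m)) (+-monoˡ-≤ m (≰⇒> (λ I≤k → outside (I≤k , <-trans k<p p<J)))))
    (λ { (_ , u≤I+m) (I≤k , _) → <⇒≱ (+-cancelʳ-≤ m (suc k) I (subst (_≤ I + m) (+-suc k m) u≤I+m)) I≤k })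

module UnrolledOrder {m} (r : Fin (suc m)) (σ : Permutation′ (suc m)) where

  pos : Fin (suc m) → ℕ
  pos = position σ

  pos-injective : ∀ {x x'} → pos x ≡ pos x' → x ≡ x'
  pos-injective e = trans (sym (inverseʳ σ)) (trans (cong (σ ⟨$⟩ʳ_) (toℕ-injective e)) (inverseʳ σ))

  pos<N : ∀ x → pos x < suc m
  pos<N x = toℕ<n (σ ⟨$⟩ˡ x)

  occupant : ∀ {q} → q < suc m → ∃[ x ] pos x ≡ q
  occupant q<N = σ ⟨$⟩ʳ fromℕ< q<N , trans (cong toℕ (inverseˡ σ)) (toℕ-fromℕ< q<N)

  ρ : Fin m → ℕ
  ρ y = unroll (suc m) (pos r) (pos (punchIn r y))

  ρ-case : ∀ y → UnrollCase (suc m) (pos r) (pos (punchIn r y)) (ρ y)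
  ρ-case y = unroll-case (punchInᵢ≢i r y ∘ pos-injective)

  ρ-injective : ∀ {y z} → ρ y ≡ ρ z → y ≡ z
  ρ-injective {y} {z} e =
    punchIn-injective r y z (pos-injective (unroll-injective (pos<N _) (pos<N _) (ρ-case y) (ρ-case z) e))

  _⪯_ : Fin m → Fin m → Set
  y ⪯ z = ρ y ≤ ρ z

  ⪯-isTotalOrder : IsTotalOrder _≡_ _⪯_
  ⪯-isTotalOrder = record
    { isPartialOrder = record
      { isPreorder = record { isEquivalence = isEquivalence ; reflexive = λ { refl → ≤-refl } ; trans = ≤-trans }
      ; antisym = λ y⪯z z⪯y → ρ-injective (≤-antisym y⪯z z⪯y) }
    ; total = λ y z → ≤-total (ρ y) (ρ z) }

  point-at : ∀ {q} → q < suc m → q ≢ pos r → ∃[ y ] pos (punchIn r y) ≡ q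
  point-at q<N q≢p with occupant q<N
  ... | x , posx≡q = punchOut r≢x , trans (cong pos (punchIn-punchOut r≢x)) posx≡q
    where
    r≢x : r ≢ x
    r≢x r≡x = q≢p (trans (sym posx≡q) (cong pos (sym r≡x)))

  attained-after : ∀ {q} → pos r < q → q < suc m → ∃[ y ] ρ y ≡ q
  attained-after p<q q<N with point-at q<N (>⇒≢ p<q)
  ... | y , refl = y , unroll-after (ρ-case y) p<q

  attained-before : ∀ {q} → q < pos r → ∃[ y ] ρ y ≡ q + suc m
  attained-before q<p with point-at (<-trans q<p (pos<N r)) (<⇒≢ q<p)
  ... | y , refl = y , unroll-before (ρ-case y) q<p

  window⇒interval : ∀ {B lo hi} → ∃[ a ] ρ a ≡ lo → ∃[ b ] ρ b ≡ hi → lo ≤ hi →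
    (∀ t → t ∈ B ⇔ (lo ≤ ρ t × ρ t ≤ hi)) → IsInterval _⪯_ B
  window⇒interval (a , refl) (b , refl) lo≤hi mem = a , b , lo≤hi , mem

  interval-avoiding : ∀ {C I J} → r ∉ C → (∀ x → x ∈ C ⇔ (I ≤ pos x × pos x < suc J)) →
    I ≤ J → J < m → IsInterval _⪯_ (γ r C)
  interval-avoiding {C} {I} {J} r∉C mem I≤J J<m with pos r <? I
  ... | yes p<I = window⇒interval (attained-after p<I I<N) (attained-after (<-≤-trans p<I I≤J) J<N) I≤J
        (λ t → ⇔-trans (∈γ-avoiding r∉C t)
                 (⇔-trans (mem (punchIn r t)) (window-after (pos<N _) (ρ-case t) p<I (<⇒≤ J<m))))
    where
    J<N = <-trans J<m (n<1+n m)
    I<N = ≤-<-trans I≤J J<N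
  ... | no p≮I =
        window⇒interval (attained-before (≤-<-trans I≤J J<p)) (attained-before J<p) (+-monoˡ-≤ (suc m) I≤J)
        (λ t → ⇔-trans (∈γ-avoiding r∉C t)
                 (⇔-trans (mem (punchIn r t)) (window-before (pos<N _) (ρ-case t) J<p)))
    where
    J<p : J < pos r
    J<p = ≮⇒≥ (λ p<1+J → r∉C (from (mem r) (≮⇒≥ p≮I , p<1+J)))

  -- A circular split C = [I, J) containing r: γ r C is its complement, which wraps around r.
  interval-containing : ∀ {C I J} → r ∈ C → (∀ x → x ∈ C ⇔ (I ≤ pos x × pos x < J)) →
    J ≤ m → IsInterval _⪯_ (γ r C)
  interval-containing {C} {I} {J} r∈C mem J≤m =
    window⇒interval (attained-after p<J (s≤s J≤m)) (upper-end I I≤p) (≤-trans J≤m (m≤n+m m I))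
      (λ t → ⇔-trans (∈γ-containing r∈C t)
               (⇔-trans (¬-⇔ (mem (punchIn r t))) (window-around (pos<N _) (ρ-case t) I≤p p<J J≤m)))
    where
    I≤p = proj₁ (to (mem r) r∈C)
    p<J = proj₂ (to (mem r) r∈C)
    -- the last point before position I, cyclically
    upper-end : ∀ I → I ≤ pos r → ∃[ b ] ρ b ≡ I + m
    upper-end zero _ = attained-after (<-≤-trans p<J J≤m) (n<1+n m)
    upper-end (suc I') I≤p with attained-before I≤p
    ... | b , ρb≡ = b , trans ρb≡ (+-suc I' m)

  circular⇒interval : ∀ {C i j} → i Fin.< j → CircInterval σ i j C → IsInterval _⪯_ (γ r C)
  circular⇒interval {C} {i} {suc j} (s≤s I≤J) circ with r ∈? C
  ... | no r∉C = interval-avoiding r∉C circ I≤J (toℕ<n j)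
  ... | yes r∈C = interval-containing r∈C circ (toℕ<n j)

  circularSplits⇒intervals : ∀ {S} → InCircularSplits σ S → ∀ A → S A → IsInterval _⪯_ (γ r A)
  circularSplits⇒intervals circular A s with circular A s
  ... | i , j , i<j , inj₁ circ = circular⇒interval i<j circ
  ... | i , j , i<j , inj₂ circ = subst (IsInterval _⪯_) (γ-∁ r A) (circular⇒interval i<j circ)

-- An injective endomap of a finite set is surjective: otherwise it would
-- inject Fin (suc n) into the complement of a point.
injective⇒surjective : ∀ {n} (f : Fin n → Fin n) → (∀ {x y} → f x ≡ f y → x ≡ y) →
  ∀ q → ∃[ y ] f y ≡ q
injective⇒surjective {suc n} f f-injective q with any? (λ y → f y ≟ q)
... | yes hit = hit
... | no miss = contradiction (λ {x} {y} → avoiding-injective {x} {y}) (<⇒notInjective (n<1+n n))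
  where
  avoiding : Fin (suc n) → Fin n
  avoiding y = punchOut {i = q} {j = f y} (λ q≡fy → miss (y , sym q≡fy))
  avoiding-injective : ∀ {x y} → avoiding x ≡ avoiding y → x ≡ y
  avoiding-injective {x} {y} e =
    f-injective (punchOut-injective (λ q≡fx → miss (x , sym q≡fx)) (λ q≡fy → miss (y , sym q≡fy)) e)

toℕ-punchIn-fromℕ : ∀ {m} (k : Fin m) → toℕ (punchIn (fromℕ m) k) ≡ toℕ k
toℕ-punchIn-fromℕ zero = refl
toℕ-punchIn-fromℕ (suc k) = cong suc (toℕ-punchIn-fromℕ k)

positions⇒circular : ∀ {n} (σ : Permutation′ n) {A I J} → I < J → J < n →
  (∀ x → x ∈ A ⇔ (I ≤ position σ x × position σ x < J)) → ∃[ i ] ∃[ j ] (i Fin.< j) × CircInterval σ i j A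
positions⇒circular σ {A} {I} {J} I<J J<n mem =
  fromℕ< I<n , fromℕ< J<n , subst₂ _<_ (sym (toℕ-fromℕ< I<n)) (sym (toℕ-fromℕ< J<n)) I<J ,
  λ x → subst₂ (λ I' J' → x ∈ A ⇔ (I' ≤ position σ x × position σ x < J'))
                (sym (toℕ-fromℕ< I<n)) (sym (toℕ-fromℕ< J<n)) (mem x)
  where
  I<n = <-trans I<J J<n

insert-self : ∀ {m n} (i : Fin (suc m)) (j : Fin (suc n)) (π : Permutation m n) → insert i j π ⟨$⟩ʳ i ≡ j
insert-self i j π with i ≟ i
... | yes _ = refl
... | no i≢i = ⊥-elim (i≢i refl)

module RankOrder {m} (r : Fin (suc m)) {_⪯_ : Rel (Fin m) 0ℓ} (tot : IsTotalOrder _≡_ _⪯_) where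
  open IsTotalOrder tot using (reflexive; antisym; total) renaming (trans to ⪯-trans)

  _≺_ : Fin m → Fin m → Set
  z ≺ y = z ⪯ y × z ≢ y

  trichotomy : ∀ y z → y ≡ z ⊎ y ≺ z ⊎ z ≺ y
  trichotomy y z with y ≟ z | total y z
  ... | yes y≡z | _ = inj₁ y≡z
  ... | no y≢z | inj₁ y⪯z = inj₂ (inj₁ (y⪯z , y≢z))
  ... | no y≢z | inj₂ z⪯y = inj₂ (inj₂ (z⪯y , y≢z ∘ sym))

  _≺?_ : ∀ z y → Dec (z ≺ y)
  z ≺? y with trichotomy z y
  ... | inj₁ refl = no (λ (_ , z≢z) → z≢z refl)
  ... | inj₂ (inj₁ z≺y) = yes z≺y
  ... | inj₂ (inj₂ (y⪯z , y≢z)) = no (λ (z⪯y , _) → y≢z (antisym y⪯z z⪯y))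

  below : Fin m → Subset m
  below y = tabulate (λ z → does (z ≺? y))

  decided : ∀ {z y} (d : Dec (z ≺ y)) → does d ≡ true → z ≺ y
  decided (yes z≺y) _ = z≺y

  ∈below⇔ : ∀ {z y} → z ∈ below y ⇔ z ≺ y
  ∈below⇔ {z} {y} = mk⇔
    (λ z∈ → decided (z ≺? y) (trans (sym (lookup∘tabulate _ z)) ([]=⇒lookup z∈)))
    (λ z≺y → lookup⇒[]= z (below y) (trans (lookup∘tabulate _ z) (dec-true (z ≺? y) z≺y)))

  rank : Fin m → ℕ
  rank y = ∣ below y ∣

  y∉below-y : ∀ y → y ∉ below y
  y∉below-y y y∈ = proj₂ (to ∈below⇔ y∈) refl

  rank-< : ∀ {y z} → y ≺ z → rank y < rank z
  rank-< {y} {z} (y⪯z , y≢z) = p⊂q⇒∣p∣<∣q∣ (below-⊆ , y , from ∈below⇔ (y⪯z , y≢z) , y∉below-y y)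
    where
    below-⊆ : ∀ {w} → w ∈ below y → w ∈ below z
    below-⊆ w∈ with to ∈below⇔ w∈
    ... | w⪯y , w≢y = from ∈below⇔ (⪯-trans w⪯y y⪯z , λ { refl → y≢z (antisym y⪯z w⪯y) })

  rank<m : ∀ y → rank y < m
  rank<m y = subst (rank y <_) (∣⊤∣≡n m) (p⊂q⇒∣p∣<∣q∣ (⊆⊤ , y , ∈⊤ , y∉below-y y))

  ⪯⇔rank≤ : ∀ y z → y ⪯ z ⇔ rank y ≤ rank z
  ⪯⇔rank≤ y z with trichotomy y z
  ... | inj₁ refl = mk⇔ (λ _ → ≤-refl) (λ _ → reflexive refl)
  ... | inj₂ (inj₁ (y⪯z , y≢z)) = mk⇔ (λ _ → <⇒≤ (rank-< (y⪯z , y≢z))) (λ _ → y⪯z)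
  ... | inj₂ (inj₂ z≺y) = mk⇔ (λ y⪯z → ⊥-elim (proj₂ z≺y (antisym (proj₁ z≺y) y⪯z)))
                              (λ y≤z → ⊥-elim (<⇒≱ (rank-< z≺y) y≤z))

  rank-injective : ∀ {y z} → rank y ≡ rank z → y ≡ z
  rank-injective {y} {z} e with trichotomy y z
  ... | inj₁ y≡z = y≡z
  ... | inj₂ (inj₁ y≺z) = ⊥-elim (<-irrefl e (rank-< y≺z))
  ... | inj₂ (inj₂ z≺y) = ⊥-elim (<-irrefl (sym e) (rank-< z≺y))

  rankFin : Fin m → Fin m
  rankFin y = fromℕ< (rank<m y)

  rankFin-injective : ∀ {y z} → rankFin y ≡ rankFin z → y ≡ z
  rankFin-injective {y} {z} e =
    rank-injective (trans (sym (toℕ-fromℕ< (rank<m y))) (trans (cong toℕ e) (toℕ-fromℕ< (rank<m z))))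

  unrank : Fin m → Fin m
  unrank q = proj₁ (injective⇒surjective rankFin rankFin-injective q)

  π : Permutation′ m
  π = permutation unrank rankFin
        (λ y → rankFin-injective (proj₂ (injective⇒surjective rankFin rankFin-injective (rankFin y))))
        (λ q → proj₂ (injective⇒surjective rankFin rankFin-injective q))

  -- σ is opaque: only the two position facts below are needed about it.
  opaque
    σ : Permutation′ (suc m)
    σ = insert (fromℕ m) r π

  opaque
    unfolding σ

    position-root : position σ r ≡ m
    position-root = begin
      position σ r                         ≡⟨ cong (position σ) (sym (insert-self (fromℕ m) r π)) ⟩
      position σ (σ ⟨$⟩ʳ fromℕ m)           ≡⟨ cong toℕ (inverseˡ σ) ⟩
      toℕ (fromℕ m)                        ≡⟨ toℕ-fromℕ m ⟩
      m                                    ∎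
      where open ≡-Reasoning

    position-punchIn : ∀ y → position σ (punchIn r y) ≡ rank y
    position-punchIn y = begin
      position σ (punchIn r y)                         ≡⟨ cong (position σ) (sym σ-rankFin) ⟩
      position σ (σ ⟨$⟩ʳ punchIn (fromℕ m) (rankFin y)) ≡⟨ cong toℕ (inverseˡ σ) ⟩
      toℕ (punchIn (fromℕ m) (rankFin y))              ≡⟨ toℕ-punchIn-fromℕ (rankFin y) ⟩
      toℕ (rankFin y)                                  ≡⟨ toℕ-fromℕ< (rank<m y) ⟩
      rank y                                           ∎
      where
      open ≡-Reasoning
      σ-rankFin : σ ⟨$⟩ʳ punchIn (fromℕ m) (rankFin y) ≡ punchIn r y
      σ-rankFin = trans (insert-punchIn (fromℕ m) r π (rankFin y)) (cong (punchIn r) (inverseʳ π))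

  -- The lift of an interval [a, b] of Y is the circular split [rank a, rank b + 1) of σ.
  interval⇒circular : ∀ {B} → IsInterval _⪯_ B → ∃[ i ] ∃[ j ] (i Fin.< j) × CircInterval σ i j (lift r B)
  interval⇒circular {B} (a , b , a⪯b , mem) =
    positions⇒circular σ (s≤s (to (⪯⇔rank≤ a b) a⪯b)) (s≤s (rank<m b)) membership
    where
    membership : ∀ x → x ∈ lift r B ⇔ (rank a ≤ position σ x × position σ x < suc (rank b))
    membership x with root-or-punchIn r x
    ... | inj₁ refl = mk⇔ (λ r∈ → ⊥-elim (root-∉-lift r B r∈))
                          (λ (_ , r<) → ⊥-elim (<⇒≱ (rank<m b) (≤-pred (subst (_< suc (rank b)) position-root r<))))
    ... | inj₂ (y , refl) =
      ⇔-trans (∈-lift r B y) (⇔-trans (mem y)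
        (⇔-trans (⪯⇔rank≤ a y ×-⇔ ⇔-trans (⪯⇔rank≤ y b) (mk⇔ s≤s ≤-pred))
                 (subst-⇔ (λ k → rank a ≤ k × k < suc (rank b)) (sym (position-punchIn y)))))

  intervals⇒circularSplits : ∀ {S} → (∀ A → S A → IsInterval _⪯_ (γ r A)) → InCircularSplits σ S
  intervals⇒circularSplits intervals A s with interval⇒circular (intervals A s) | partAvoiding-either r A
  ... | i , j , i<j , circ | inj₁ C≡A =
    i , j , i<j , inj₁ (subst (CircInterval σ i j) (trans (lift-γ r A) C≡A) circ)
  ... | i , j , i<j , circ | inj₂ C≡∁A =
    i , j , i<j , inj₂ (subst (CircInterval σ i j) (trans (lift-γ r A) C≡∁A) circ)

γ-CUF⇒PP : ∀ {m} → 1 ≤ m → (r : Fin (suc m)) (S : Family (suc m)) → CUF S → PP (γFam r S)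
γ-CUF⇒PP {suc m} (s≤s z≤n) r S ((ss , σ , circular) , (_ , unrooted)) =
  Prepyramid-resp view≐γFam prepyramid , RootedFamily-resp view≐γFam (unrooted⇒rooted r complClosed unrooted)
  where
  open SplitSystem ss using (complClosed)
  open UnrolledOrder r σ using (_⪯_; ⪯-isTotalOrder; circularSplits⇒intervals)
  view≐γFam : rootedView r S ≐ γFam r S
  view≐γFam = ≐-sym (γFam≐rootedView r complClosed)
  prepyramid : Prepyramid (rootedView r S)
  prepyramid =
    subst S (sym (lift-⊤ r)) (complClosed ⁅ r ⁆ (singleton-member ss (punchInᵢ≢i r zero))) ,
    (λ y → subst S (sym (lift-⁅⁆ r y)) (singleton-member ss (punchInᵢ≢i r y ∘ sym))) ,
    _⪯_ , ⪯-isTotalOrder ,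
    λ B s → subst (IsInterval _⪯_) (γ-lift r B) (circularSplits⇒intervals circular (lift r B) s)

γ-injective : ∀ {m} (r : Fin (suc m)) (S₁ S₂ : Family (suc m)) → CUF S₁ → CUF S₂ →
  γFam r S₁ ≐ γFam r S₂ → S₁ ≐ S₂
γ-injective r S₁ S₂ ((ss₁ , _) , _) ((ss₂ , _) , _) same =
  rootedView-determines r closed₁ closed₂
    (≐-trans (≐-sym (γFam≐rootedView r closed₁)) (≐-trans same (γFam≐rootedView r closed₂)))
  where
  closed₁ = SplitSystem.complClosed ss₁
  closed₂ = SplitSystem.complClosed ss₂

γ-surjective : ∀ {m} (r : Fin (suc m)) (P : Family m) → PP P → ∃[ S ] CUF S × (γFam r S ≐ P)
γ-surjective r P ((top , singles , _⪯_ , tot , intervals) , rooted) =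
  S , ((splitSystem , RankOrder.σ r tot , RankOrder.intervals⇒circularSplits r tot (λ A → intervals (γ r A))) ,
       (splitSystem , rooted⇒unrooted r closed (RootedFamily-resp (≐-sym view≐P) rooted))) ,
  ≐-trans (γFam≐rootedView r closed) view≐P
  where
  S : Family _
  S A = P (γ r A)
  closed : ComplementClosed S
  closed A = subst P (sym (γ-∁ r A))
  view≐P : rootedView r S ≐ P
  view≐P B = subst-⇔ P (γ-lift r B)
  singleton : ∀ x → S ⁅ x ⁆
  singleton x with root-or-punchIn r x
  ... | inj₁ refl = subst P (sym (γ-⁅root⁆ r)) top
  ... | inj₂ (y , refl) = subst P (sym (γ-⁅punchIn⁆ r y)) (singles y)
  splitSystem : SplitSystem S
  splitSystem = record
    { onlySplits = λ A p → γ-nonempty⇒split r A (interval-nonempty tot (intervals (γ r A) p))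
    ; complClosed = closed
    ; hasTrivial = λ { A _ (inj₁ (x , refl)) → singleton x
                     ; A _ (inj₂ (x , ∁A≡⁅x⁆)) → subst P (γ-∁ r A) (subst S (sym ∁A≡⁅x⁆) (singleton x)) }
    }

proposition4p6 : (m : ℕ) → 1 ≤ m → (r : Fin (suc m)) →
    ((S : Family (suc m)) → CUF S → PP (γFam r S)) ×
    ((S₁ S₂ : Family (suc m)) → CUF S₁ → CUF S₂ →
       γFam r S₁ ≐ γFam r S₂ → S₁ ≐ S₂) ×
    ((P : Family m) → PP P → ∃[ S ] CUF S × (γFam r S ≐ P))
proposition4p6 m 1≤m r = γ-CUF⇒PP 1≤m r , γ-injective r , γ-surjective r
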